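{- For every positive integer $n$, $$\vartheta_2\left(\sum_{k=1}^{n} \frac{2^k}{k}\right) \geq s_2(n).$$
   Context: $\vartheta_2$ denotes the $2$-adic valuation (extended to nonzero rationals by $\vartheta_2(a/b) = \vartheta_2(a) - \vartheta_2(b)$), and $s_2(n)$ denotes the sum of the binary digits of $n$. -}

module Defs where

open import Data.Nat as ℕ using (ℕ; zero; suc; _+_; _^_; _%_; _/_)
open import Data.Nat.Divisibility using (_∣?_)
open import Data.Integer as ℤ using (ℤ; +_; _-_; ∣_∣)
open import Data.Rational as ℚ using (ℚ; ↥_; ↧ₙ_)
open import Relation.Nullary.Decidable using (yes; no)

-- Computed with fuel (fuel = m suffices since ϑ₂(m) < m for m ≥ 1).
-- The value at m = 0 is irrelevant (statement only uses nonzero arguments).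
ν₂-fuel : ℕ → ℕ → ℕ
ν₂-fuel zero    m = zero
ν₂-fuel (suc f) zero = zero
ν₂-fuel (suc f) m@(suc _) with 2 ∣? m
... | yes _ = suc (ν₂-fuel f (m / 2))
... | no  _ = zero

ν₂ℕ : ℕ → ℕ
ν₂ℕ m = ν₂-fuel m m

ϑ₂ : ℚ → ℤ
ϑ₂ q = + ν₂ℕ ∣ ↥ q ∣ - + ν₂ℕ (↧ₙ q)

s₂-fuel : ℕ → ℕ → ℕ
s₂-fuel zero    m = zero
s₂-fuel (suc f) zero = zero
s₂-fuel (suc f) m@(suc _) = m % 2 + s₂-fuel f (m / 2)

s₂ : ℕ → ℕ
s₂ m = s₂-fuel m m

harmonic2 : ℕ → ℚ
harmonic2 zero    = ℚ.0ℚ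
harmonic2 (suc j) = harmonic2 j ℚ.+ ((+ (2 ^ suc j)) ℚ./ suc j)

-- Write Σ_{k=1}^{n} 2^k/k = N(n)/n!. The numerator satisfies
-- N(m+1) = 2^(m+1) · Σ_{j=0}^{m} j! (m−j)!  (equivalently Σ_{k=1}^{n} 2^k/k = (2^n/n) Σ_j 1/binom(n−1, j)),
-- so ν₂(N(n)) ≥ n, whereas Legendre's formula gives ν₂(n!) = n − s₂(n). As ν₂ is additive on
-- products, ϑ₂ of a rational may be computed from any representation a/d as ν₂(a) − ν₂(d), whence
-- ϑ₂ ≥ n − (n − s₂(n)) = s₂(n).
module Submission where

open import Defs
open import Data.Nat as ℕ
  using (ℕ; zero; suc; _+_; _*_; _^_; _!; _%_; _/_; z≤n; s≤s; z<s; NonZero; ≢-nonZero; ≢-nonZero⁻¹; >-nonZero; >-nonZero⁻¹)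
open import Data.Nat.Properties
open import Data.Nat.DivMod using (m*n/n≡m; m*n%n≡0; [m+kn]%n≡m%n; m/n<m; +-distrib-/-∣ʳ)
open import Data.Nat.Divisibility using (_∣_; _∣?_; divides; _∣0; n∣m⇒m%n≡0)
open import Data.Nat.Induction using (<-rec)
open import Data.Nat.Primality using (euclidsLemma; prime[2])
open import Data.Nat.Tactic.RingSolver using (solve-∀)
open import Data.Integer as ℤ using (+_; _≤_; +≤+; _-_; _⊖_; ∣_∣)
import Data.Integer.Properties as ℤP
open import Data.Rational as ℚ using (mkℚ; toℚᵘ)
open import Data.Rational.Properties using (toℚᵘ-homo-+; toℚᵘ-fromℚᵘ)
open import Data.Rational.Unnormalised as ℚᵘ using (_≃_; *≡*)
import Data.Rational.Unnormalised.Properties as ℚᵘP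
open import Data.Product using (∃₂; _×_; _,_)
open import Data.Sum using ([_,_]′)
open import Function using (_∘_)
open import Relation.Nullary using (¬_; yes; no; contradiction)
open import Relation.Binary.PropositionalEquality
open ≡-Reasoning

data Parity : ℕ → Set where
  even : ∀ j → Parity (j * 2)
  odd  : ∀ j → Parity (1 + j * 2)

parity : ∀ n → Parity n
parity zero = even 0
parity (suc n) with parity n
... | even j = odd j
... | odd j  = even (suc j)

1+j*2-odd : ∀ j → ¬ 2 ∣ 1 + j * 2
1+j*2-odd j 2∣1+j*2 with trans (sym ([m+kn]%n≡m%n 1 j 2)) (n∣m⇒m%n≡0 _ 2 2∣1+j*2)
... | ()

odd-* : ∀ {u w} → ¬ 2 ∣ u → ¬ 2 ∣ w → ¬ 2 ∣ u * w
odd-* {u} {w} 2∤u 2∤w 2∣uw = [ 2∤u , 2∤w ]′ (euclidsLemma u w prime[2] 2∣uw)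

odd⇒nonZero : ∀ {u} → ¬ 2 ∣ u → NonZero u
odd⇒nonZero {zero}  2∤0 = contradiction (2 ∣0) 2∤0
odd⇒nonZero {suc _} _   = _

n<2^n : ∀ n → n ℕ.< 2 ^ n
n<2^n zero    = z<s
n<2^n (suc n) = ≤-<-trans (n<2^n n) (^-monoʳ-< 2 (s≤s (s≤s z≤n)) (n<1+n n))

2^[1+k]*u≡2^k*u*2 : ∀ k u → 2 ^ suc k * u ≡ 2 ^ k * u * 2
2^[1+k]*u≡2^k*u*2 k u = trans (*-assoc 2 (2 ^ k) u) (*-comm 2 (2 ^ k * u))

ν₂-fuel-odd : ∀ f {u} → ¬ 2 ∣ u → ν₂-fuel f u ≡ 0
ν₂-fuel-odd zero    _ = refl
ν₂-fuel-odd (suc f) {zero}  2∤0 = contradiction (2 ∣0) 2∤0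
ν₂-fuel-odd (suc f) {suc u} 2∤u with 2 ∣? suc u
... | yes 2∣u = contradiction 2∣u 2∤u
... | no  _   = refl

ν₂-fuel-double : ∀ f m .{{_ : NonZero m}} → ν₂-fuel (suc f) (m * 2) ≡ suc (ν₂-fuel f m)
ν₂-fuel-double f m@(suc _) with 2 ∣? m * 2
... | yes _   = cong (suc ∘ ν₂-fuel f) (m*n/n≡m m 2)
... | no  2∤m*2 = contradiction (divides m refl) 2∤m*2

ν₂-fuel-2^k*odd : ∀ {f} k {u} → k ℕ.≤ f → ¬ 2 ∣ u → ν₂-fuel f (2 ^ k * u) ≡ k
ν₂-fuel-2^k*odd {f} zero {u} _ 2∤u = trans (cong (ν₂-fuel f) (*-identityˡ u)) (ν₂-fuel-odd f 2∤u)
ν₂-fuel-2^k*odd {suc f} (suc k) {u} (s≤s k≤f) 2∤u = begin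
  ν₂-fuel (suc f) (2 * 2 ^ k * u)   ≡⟨ cong (ν₂-fuel (suc f)) (2^[1+k]*u≡2^k*u*2 k u) ⟩
  ν₂-fuel (suc f) (2 ^ k * u * 2)   ≡⟨ ν₂-fuel-double f (2 ^ k * u) {{m*n≢0 _ _ {{m^n≢0 2 k}} {{odd⇒nonZero 2∤u}}}} ⟩
  suc (ν₂-fuel f (2 ^ k * u))       ≡⟨ cong suc (ν₂-fuel-2^k*odd k k≤f 2∤u) ⟩
  suc k                             ∎

ν₂ℕ-2^k*odd : ∀ k {u} → ¬ 2 ∣ u → ν₂ℕ (2 ^ k * u) ≡ k
ν₂ℕ-2^k*odd k {u} 2∤u =
  ν₂-fuel-2^k*odd k (≤-trans (<⇒≤ (n<2^n k)) (m≤m*n (2 ^ k) u {{odd⇒nonZero 2∤u}})) 2∤u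

ν₂ℕ-odd : ∀ {u} → ¬ 2 ∣ u → ν₂ℕ u ≡ 0
ν₂ℕ-odd {u} = ν₂-fuel-odd u

2-adic-decomposition : ∀ m .{{_ : NonZero m}} → ∃₂ λ k u → ¬ 2 ∣ u × m ≡ 2 ^ k * u
2-adic-decomposition = <-rec _ decompose
  where
  Decomposition : ℕ → Set
  Decomposition m = .{{_ : NonZero m}} → ∃₂ λ k u → ¬ 2 ∣ u × m ≡ 2 ^ k * u
  decompose : ∀ m → (∀ {j} → j ℕ.< m → Decomposition j) → Decomposition m
  decompose m rec with parity m
  ... | odd j  = 0 , 1 + j * 2 , 1+j*2-odd j , sym (*-identityˡ _)
  ... | even j with rec (m<m*n j 2 {{m*n≢0⇒m≢0 j}} (s≤s (s≤s z≤n))) {{m*n≢0⇒m≢0 j}}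
  ...   | k , u , 2∤u , j≡2^k*u = suc k , u , 2∤u , (begin
    j * 2             ≡⟨ cong (_* 2) j≡2^k*u ⟩
    2 ^ k * u * 2     ≡⟨ 2^[1+k]*u≡2^k*u*2 k u ⟨
    2 * 2 ^ k * u     ∎)

ν₂ℕ-* : ∀ a b .{{_ : NonZero a}} .{{_ : NonZero b}} → ν₂ℕ (a * b) ≡ ν₂ℕ a + ν₂ℕ b
ν₂ℕ-* a b with 2-adic-decomposition a | 2-adic-decomposition b
... | i , u , 2∤u , refl | j , w , 2∤w , refl = begin
  ν₂ℕ (2 ^ i * u * (2 ^ j * w))  ≡⟨ cong ν₂ℕ (trans (interchange (2 ^ i) u (2 ^ j) w) (cong (_* (u * w)) (sym (^-distribˡ-+-* 2 i j)))) ⟩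
  ν₂ℕ (2 ^ (i + j) * (u * w))    ≡⟨ ν₂ℕ-2^k*odd (i + j) (odd-* 2∤u 2∤w) ⟩
  i + j                          ≡⟨ sym (cong₂ _+_ (ν₂ℕ-2^k*odd i 2∤u) (ν₂ℕ-2^k*odd j 2∤w)) ⟩
  ν₂ℕ (2 ^ i * u) + ν₂ℕ (2 ^ j * w) ∎
  where
  interchange : ∀ a u b w → a * u * (b * w) ≡ a * b * (u * w)
  interchange = solve-∀

ν₂ℕ-double : ∀ m .{{_ : NonZero m}} → ν₂ℕ (m * 2) ≡ suc (ν₂ℕ m)
ν₂ℕ-double m = trans (ν₂ℕ-* m 2) (+-comm (ν₂ℕ m) 1)

ν₂ℕ-2^k* : ∀ k m .{{_ : NonZero m}} → ν₂ℕ (2 ^ k * m) ≡ k + ν₂ℕ m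
ν₂ℕ-2^k* k m = begin
  ν₂ℕ (2 ^ k * m)        ≡⟨ ν₂ℕ-* (2 ^ k) m {{m^n≢0 2 k}} ⟩
  ν₂ℕ (2 ^ k) + ν₂ℕ m    ≡⟨ cong (λ i → ν₂ℕ i + ν₂ℕ m) (sym (*-identityʳ (2 ^ k))) ⟩
  ν₂ℕ (2 ^ k * 1) + ν₂ℕ m ≡⟨ cong (_+ ν₂ℕ m) (ν₂ℕ-2^k*odd k (1+j*2-odd 0)) ⟩
  k + ν₂ℕ m              ∎

[1+k]/2≤k : ∀ k → suc k / 2 ℕ.≤ k
[1+k]/2≤k k = ≤-pred (m/n<m (suc k) 2 (s≤s (s≤s z≤n)))

s₂-fuel-irrelevant : ∀ {f g} m → m ℕ.≤ f → m ℕ.≤ g → s₂-fuel f m ≡ s₂-fuel g m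
s₂-fuel-irrelevant {zero}  {zero}  zero _ _ = refl
s₂-fuel-irrelevant {zero}  {suc _} zero _ _ = refl
s₂-fuel-irrelevant {suc _} {zero}  zero _ _ = refl
s₂-fuel-irrelevant {suc _} {suc _} zero _ _ = refl
s₂-fuel-irrelevant {suc f} {suc g} (suc k) (s≤s k≤f) (s≤s k≤g) =
  cong (_+_ (suc k % 2)) (s₂-fuel-irrelevant (suc k / 2) (≤-trans ([1+k]/2≤k k) k≤f) (≤-trans ([1+k]/2≤k k) k≤g))

s₂-suc : ∀ k → s₂ (suc k) ≡ suc k % 2 + s₂ (suc k / 2)
s₂-suc k = cong (_+_ (suc k % 2)) (s₂-fuel-irrelevant (suc k / 2) ([1+k]/2≤k k) ≤-refl)

s₂-even : ∀ j → s₂ (j * 2) ≡ s₂ j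
s₂-even zero    = refl
s₂-even (suc j) = trans (s₂-suc (suc (j * 2))) (cong₂ _+_ (m*n%n≡0 (suc j) 2) (cong s₂ (m*n/n≡m (suc j) 2)))

s₂-odd : ∀ j → s₂ (1 + j * 2) ≡ suc (s₂ j)
s₂-odd j = trans (s₂-suc (j * 2)) (cong₂ _+_ ([m+kn]%n≡m%n 1 j 2) (cong s₂ half))
  where
  half : (1 + j * 2) / 2 ≡ j
  half = trans (+-distrib-/-∣ʳ 1 {d = 2} (divides j refl)) (m*n/n≡m j 2)

-- Passing from n to n + 1 turns ν₂(n + 1) trailing ones into zeros and one zero into a one.
ν₂ℕ-suc+s₂-suc : ∀ n → ν₂ℕ (suc n) + s₂ (suc n) ≡ suc (s₂ n)
ν₂ℕ-suc+s₂-suc = <-rec _ carry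
  where
  carry : ∀ n → (∀ {j} → j ℕ.< n → ν₂ℕ (suc j) + s₂ (suc j) ≡ suc (s₂ j)) →
          ν₂ℕ (suc n) + s₂ (suc n) ≡ suc (s₂ n)
  carry n rec with parity n
  ... | even j = begin
    ν₂ℕ (1 + j * 2) + s₂ (1 + j * 2) ≡⟨ cong₂ _+_ (ν₂ℕ-odd (1+j*2-odd j)) (s₂-odd j) ⟩
    suc (s₂ j)                       ≡⟨ cong suc (s₂-even j) ⟨
    suc (s₂ (j * 2))                 ∎
  ... | odd j = begin
    ν₂ℕ (suc j * 2) + s₂ (suc j * 2) ≡⟨ cong₂ _+_ (ν₂ℕ-double (suc j)) (s₂-even (suc j)) ⟩
    suc (ν₂ℕ (suc j) + s₂ (suc j))   ≡⟨ cong suc (rec (s≤s (m≤m*n j 2))) ⟩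
    suc (suc (s₂ j))                 ≡⟨ cong suc (s₂-odd j) ⟨
    suc (s₂ (1 + j * 2))             ∎

ν₂ℕ-!+s₂ : ∀ n → ν₂ℕ (n !) + s₂ n ≡ n
ν₂ℕ-!+s₂ zero    = refl
ν₂ℕ-!+s₂ (suc n) = begin
  ν₂ℕ (suc n * n !) + s₂ (suc n)           ≡⟨ cong (_+ s₂ (suc n)) (ν₂ℕ-* (suc n) (n !) {{_}} {{n !≢0}}) ⟩
  ν₂ℕ (suc n) + ν₂ℕ (n !) + s₂ (suc n)     ≡⟨ cong (_+ s₂ (suc n)) (+-comm (ν₂ℕ (suc n)) _) ⟩
  ν₂ℕ (n !) + ν₂ℕ (suc n) + s₂ (suc n)     ≡⟨ +-assoc (ν₂ℕ (n !)) _ _ ⟩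
  ν₂ℕ (n !) + (ν₂ℕ (suc n) + s₂ (suc n))   ≡⟨ cong (_+_ (ν₂ℕ (n !))) (ν₂ℕ-suc+s₂-suc n) ⟩
  ν₂ℕ (n !) + suc (s₂ n)                   ≡⟨ +-suc (ν₂ℕ (n !)) (s₂ n) ⟩
  suc (ν₂ℕ (n !) + s₂ n)                   ≡⟨ cong suc (ν₂ℕ-!+s₂ n) ⟩
  suc n                                    ∎

-- factorial-convolution k r = Σ_{j=0}^{k} j! (k + r − j)!
factorial-convolution : ℕ → ℕ → ℕ
factorial-convolution zero    r = r !
factorial-convolution (suc k) r = factorial-convolution k (suc r) + suc k ! * r !

factorial-convolution-nonZero : ∀ k r → NonZero (factorial-convolution k r)
factorial-convolution-nonZero zero    r = r !≢0
factorial-convolution-nonZero (suc k) r =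
  >-nonZero (≤-trans (>-nonZero⁻¹ _ {{factorial-convolution-nonZero k (suc r)}}) (m≤m+n _ _))

factorial-convolution-recurrence : ∀ k r →
  (2 + r + k) * factorial-convolution k r + (1 + r + k) ! ≡ 2 * factorial-convolution k (suc r) + suc k ! * r !
factorial-convolution-recurrence zero    r rewrite +-identityʳ r = regroup r (r !)
  where
  regroup : ∀ r R → (2 + r) * R + suc r * R ≡ 2 * (suc r * R) + 1 * R
  regroup = solve-∀
factorial-convolution-recurrence (suc k) r = begin
  (2 + r + suc k) * (Q k (suc r) + F * r !) + (1 + r + suc k) !
    ≡⟨ cong (λ i → (2 + i) * (Q k (suc r) + F * r !) + (1 + i) !) (+-suc r k) ⟩
  (2 + suc r + k) * (Q k (suc r) + F * r !) + (1 + suc r + k) !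
    ≡⟨ expand (2 + suc r + k) (Q k (suc r)) (F * r !) ((1 + suc r + k) !) ⟩
  ((2 + suc r + k) * Q k (suc r) + (1 + suc r + k) !) + (2 + suc r + k) * (F * r !)
    ≡⟨ cong (_+ (2 + suc r + k) * (F * r !)) (factorial-convolution-recurrence k (suc r)) ⟩
  (2 * Q k (suc (suc r)) + F * suc r !) + (2 + suc r + k) * (F * r !)
    ≡⟨ regroup r k (Q k (suc (suc r))) F (r !) ⟩
  2 * (Q k (suc (suc r)) + F * suc r !) + suc (suc k) ! * r ! ∎
  where
  Q : ℕ → ℕ → ℕ
  Q = factorial-convolution
  F : ℕ
  F = suc k !
  expand : ∀ a q t x → a * (q + t) + x ≡ (a * q + x) + a * t
  expand = solve-∀
  regroup : ∀ r k q F R → (2 * q + F * (suc r * R)) + (2 + suc r + k) * (F * R) ≡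
                          2 * (q + F * (suc r * R)) + (suc (suc k) * F) * R
  regroup = solve-∀

factorial-convolution-doubling : ∀ m →
  (2 + m) * factorial-convolution m 0 + 2 * suc m ! ≡ 2 * factorial-convolution (suc m) 0
factorial-convolution-doubling m = begin
  (2 + m) * Q m 0 + 2 * F           ≡⟨ split ((2 + m) * Q m 0) F ⟩
  ((2 + m) * Q m 0 + F) + F         ≡⟨ cong (_+ F) (factorial-convolution-recurrence m 0) ⟩
  (2 * Q m 1 + F * 1) + F           ≡⟨ merge (Q m 1) F ⟩
  2 * (Q m 1 + F * 1)               ∎
  where
  Q : ℕ → ℕ → ℕ
  Q = factorial-convolution
  F : ℕ
  F = suc m !
  split : ∀ a F → a + 2 * F ≡ (a + F) + F
  split = solve-∀
  merge : ∀ q F → (2 * q + F * 1) + F ≡ 2 * (q + F * 1)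
  merge = solve-∀

harmonic2-numerator : ℕ → ℕ
harmonic2-numerator zero    = 0
harmonic2-numerator (suc n) = suc n * harmonic2-numerator n + 2 ^ suc n * n !

harmonic2-numerator-suc : ∀ m → harmonic2-numerator (suc m) ≡ 2 ^ suc m * factorial-convolution m 0
harmonic2-numerator-suc zero    = refl
harmonic2-numerator-suc (suc m) = begin
  (2 + m) * harmonic2-numerator (suc m) + 2 * P * suc m !
    ≡⟨ cong (λ x → (2 + m) * x + 2 * P * suc m !) (harmonic2-numerator-suc m) ⟩
  (2 + m) * (P * Q m 0) + 2 * P * suc m !
    ≡⟨ factor (2 + m) P (Q m 0) (suc m !) ⟩
  P * ((2 + m) * Q m 0 + 2 * suc m !)
    ≡⟨ cong (P *_) (factorial-convolution-doubling m) ⟩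
  P * (2 * Q (suc m) 0)
    ≡⟨ swap P (Q (suc m) 0) ⟩
  2 * P * Q (suc m) 0 ∎
  where
  Q : ℕ → ℕ → ℕ
  Q = factorial-convolution
  P : ℕ
  P = 2 ^ suc m
  factor : ∀ a P q F → a * (P * q) + 2 * P * F ≡ P * (a * q + 2 * F)
  factor = solve-∀
  swap : ∀ P q → P * (2 * q) ≡ 2 * P * q
  swap = solve-∀

harmonic2-numerator-nonZero : ∀ n → NonZero (harmonic2-numerator (suc n))
harmonic2-numerator-nonZero n = >-nonZero (≤-trans 0<2^[1+n]*n! (m≤n+m _ _))
  where
  0<2^[1+n]*n! : 0 ℕ.< 2 ^ suc n * n !
  0<2^[1+n]*n! = >-nonZero⁻¹ _ {{m*n≢0 (2 ^ suc n) (n !) {{m^n≢0 2 (suc n)}} {{n !≢0}}}}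

/-+-/ : ∀ a b c d .{{_ : NonZero b}} .{{_ : NonZero d}} →
       + a ℚᵘ./ b ℚᵘ.+ + c ℚᵘ./ d ≃ (+ (d * a + c * b) ℚᵘ./ (d * b)) {{m*n≢0 d b}}
/-+-/ a b@(suc _) c d@(suc _) = *≡* (begin
  (+ a ℤ.* + d ℤ.+ + c ℤ.* + b) ℤ.* + (d * b)  ≡⟨ cong (ℤ._* + (d * b)) (cong₂ ℤ._+_ (ℤP.pos-* a d) (ℤP.pos-* c b)) ⟨
  (+ (a * d) ℤ.+ + (c * b)) ℤ.* + (d * b)      ≡⟨ cong (ℤ._* + (d * b)) (ℤP.pos-+ (a * d) (c * b)) ⟨
  + (a * d + c * b) ℤ.* + (d * b)              ≡⟨ ℤP.pos-* (a * d + c * b) (d * b) ⟨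
  + ((a * d + c * b) * (d * b))                ≡⟨ cong +_ (cross a b c d) ⟩
  + ((d * a + c * b) * (b * d))                ≡⟨ ℤP.pos-* (d * a + c * b) (b * d) ⟩
  + (d * a + c * b) ℤ.* + (b * d)              ∎)
  where
  cross : ∀ a b c d → (a * d + c * b) * (d * b) ≡ (d * a + c * b) * (b * d)
  cross = solve-∀

toℚᵘ-harmonic2 : ∀ n → toℚᵘ (harmonic2 n) ≃ (+ harmonic2-numerator n ℚᵘ./ n !) {{n !≢0}}
toℚᵘ-harmonic2 zero    = ℚᵘP.≃-refl
toℚᵘ-harmonic2 (suc n) =
  ℚᵘP.≃-trans (toℚᵘ-homo-+ (harmonic2 n) (+ 2 ^ suc n ℚ./ suc n))
  (ℚᵘP.≃-trans (ℚᵘP.+-cong (toℚᵘ-harmonic2 n) (toℚᵘ-fromℚᵘ (+ 2 ^ suc n ℚᵘ./ suc n)))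
  (/-+-/ (harmonic2-numerator n) (n !) (2 ^ suc n) (suc n) {{n !≢0}}))

m+n≡o+p⇒+m-+p≡+o-+n : ∀ {m n o p} → m + n ≡ o + p → + m - + p ≡ + o - + n
m+n≡o+p⇒+m-+p≡+o-+n {m} {n} {o} {p} m+n≡o+p = begin
  + m - + p            ≡⟨ ℤP.[+m]-[+n]≡m⊖n m p ⟩
  m ⊖ p                ≡⟨ ℤP.+-cancelˡ-⊖ n m p ⟨
  (n + m) ⊖ (n + p)    ≡⟨ cong₂ _⊖_ (trans (+-comm n m) (trans m+n≡o+p (+-comm o p))) (+-comm n p) ⟩
  (p + o) ⊖ (p + n)    ≡⟨ ℤP.+-cancelˡ-⊖ p o n ⟩
  o ⊖ n                ≡⟨ ℤP.[+m]-[+n]≡m⊖n o n ⟨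
  + o - + n            ∎

+[m+n]-+m≡+n : ∀ m n → + (m + n) - + m ≡ + n
+[m+n]-+m≡+n m n = trans (ℤP.[+m]-[+n]≡m⊖n (m + n) m) (trans (ℤP.⊖-≥ (m≤m+n m n)) (cong +_ (m+n∸m≡n m n)))

ϑ₂-/ : ∀ q a d .{{_ : NonZero a}} .{{_ : NonZero d}} → toℚᵘ q ≃ + a ℚᵘ./ d → ϑ₂ q ≡ + ν₂ℕ a - + ν₂ℕ d
ϑ₂-/ (mkℚ p e _) a d@(suc _) (*≡* p*d≡a*e) = m+n≡o+p⇒+m-+p≡+o-+n {ν₂ℕ ∣ p ∣} {ν₂ℕ d} (begin
  ν₂ℕ ∣ p ∣ + ν₂ℕ d        ≡⟨ ν₂ℕ-* ∣ p ∣ d {{≢-nonZero ∣p∣≢0}} ⟨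
  ν₂ℕ (∣ p ∣ * d)          ≡⟨ cong ν₂ℕ ∣p∣*d≡a*e ⟩
  ν₂ℕ (a * suc e)          ≡⟨ ν₂ℕ-* a (suc e) ⟩
  ν₂ℕ a + ν₂ℕ (suc e)      ∎)
  where
  ∣p∣*d≡a*e : ∣ p ∣ * d ≡ a * suc e
  ∣p∣*d≡a*e = trans (sym (ℤP.abs-* p (+ d))) (trans (cong ∣_∣ p*d≡a*e) (ℤP.abs-* (+ a) (+ suc e)))
  ∣p∣≢0 : ∣ p ∣ ≢ 0
  ∣p∣≢0 ∣p∣≡0 = ≢-nonZero⁻¹ (a * suc e) {{m*n≢0 a (suc e)}} (trans (sym ∣p∣*d≡a*e) (cong (_* d) ∣p∣≡0))

corollary3 : ∀ (n : ℕ) → + s₂ (suc n) ≤ ϑ₂ (harmonic2 (suc n))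
corollary3 n = subst (+ s₂ m ≤_) (sym ϑ₂-harmonic2) (+≤+ (m≤m+n (s₂ m) (ν₂ℕ V)))
  where
  m V : ℕ
  m = suc n
  V = factorial-convolution n 0
  instance
    V≢0 : NonZero V
    V≢0 = factorial-convolution-nonZero n 0
    numerator≢0 : NonZero (harmonic2-numerator m)
    numerator≢0 = harmonic2-numerator-nonZero n
    m!≢0 : NonZero (m !)
    m!≢0 = m !≢0
  ν₂-numerator : ν₂ℕ (harmonic2-numerator m) ≡ ν₂ℕ (m !) + (s₂ m + ν₂ℕ V)
  ν₂-numerator = begin
    ν₂ℕ (harmonic2-numerator m)   ≡⟨ cong ν₂ℕ (harmonic2-numerator-suc n) ⟩
    ν₂ℕ (2 ^ m * V)               ≡⟨ ν₂ℕ-2^k* m V ⟩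
    m + ν₂ℕ V                     ≡⟨ cong (_+ ν₂ℕ V) (ν₂ℕ-!+s₂ m) ⟨
    ν₂ℕ (m !) + s₂ m + ν₂ℕ V      ≡⟨ +-assoc (ν₂ℕ (m !)) (s₂ m) (ν₂ℕ V) ⟩
    ν₂ℕ (m !) + (s₂ m + ν₂ℕ V)    ∎
  ϑ₂-harmonic2 : ϑ₂ (harmonic2 m) ≡ + (s₂ m + ν₂ℕ V)
  ϑ₂-harmonic2 = begin
    ϑ₂ (harmonic2 m)                                  ≡⟨ ϑ₂-/ (harmonic2 m) _ (m !) (toℚᵘ-harmonic2 m) ⟩
    + ν₂ℕ (harmonic2-numerator m) - + ν₂ℕ (m !)       ≡⟨ cong (λ k → + k - + ν₂ℕ (m !)) ν₂-numerator ⟩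
    + (ν₂ℕ (m !) + (s₂ m + ν₂ℕ V)) - + ν₂ℕ (m !)      ≡⟨ +[m+n]-+m≡+n (ν₂ℕ (m !)) (s₂ m + ν₂ℕ V) ⟩
    + (s₂ m + ν₂ℕ V)                                  ∎
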